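{- Let $\alpha=(\alpha_1,\ldots,\alpha_n)\in\mathbb{Z}_{\ge0}^n$. The rank of the Tesler poset $P(\alpha)$ (the maximum rank of its elements) is $\sum_{i=1}^n(n-i)\alpha_i$.
   Context: Let $U_n$ be the set of $n\times n$ upper-triangular matrices with nonnegative integer entries. For $A=(a_{i,j})\in U_n$ and $1\le k\le n$, the $k$-th hook sum is $h_k=(a_{k,k}+\cdots+a_{k,n})-(a_{1,k}+\cdots+a_{k-1,k})$. $\mathcal{T}(\alpha)$ is the set of $A\in U_n$ with $(h_1,\ldots,h_n)=\alpha$. The Tesler poset $P(\alpha)$ is the partial order on $\mathcal{T}(\alpha)$ that is the reflexive-transitive closure of the cover relation: $A=(a_{ij})$ covers $B=(b_{ij})$ if either there exist $i<j<k$ with $a_{ij}=b_{ij}+1$, $a_{jk}=b_{jk}+1$, $a_{ik}=b_{ik}-1$ and all other entries equal, or there exist $i<j$ with $a_{ij}=b_{ij}+1$, $a_{jj}=b_{jj}+1$, $a_{ii}=b_{ii}-1$ and all other entries equal. The least element is the diagonal matrix with diagonal $\alpha$, and the rank of an element is the length of a saturated chain from the least element to it. -}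

module Defs where

open import Data.Nat using (ℕ; zero; suc; _+_; _*_; _∸_; _≤_; _<_)
open import Data.Integer using (ℤ; +_; _-_)
open import Data.Fin using (Fin; toℕ) renaming (_<_ to _<ᶠ_; _≤_ to _≤ᶠ_)
open import Data.Fin.Properties using (_≟_) renaming (_<?_ to _<ᶠ?_; _≤?_ to _≤ᶠ?_)
open import Data.List using (List; map; allFin)
open import Data.Nat.ListAction using (sum)
open import Data.Bool using (if_then_else_; _∧_)
open import Data.Product using (Σ; _×_; ∃)
open import Relation.Nullary.Decidable using (⌊_⌋)
open import Relation.Binary.PropositionalEquality using (_≡_)

Mat : ℕ → Set
Mat n = Fin n → Fin n → ℕ

Σ[_]_ : (n : ℕ) → (Fin n → ℕ) → ℕ
Σ[ n ] f = sum (map f (allFin n))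

UpperTriangular : ∀ {n} → Mat n → Set
UpperTriangular {n} A = ∀ (i j : Fin n) → j <ᶠ i → A i j ≡ 0

hook : ∀ {n} → Mat n → Fin n → ℤ
hook {n} A k =
  (+ (Σ[ n ] λ j → if ⌊ k ≤ᶠ? j ⌋ then A k j else 0))
  - (+ (Σ[ n ] λ i → if ⌊ i <ᶠ? k ⌋ then A i k else 0))

InT : ∀ {n} → (Fin n → ℕ) → Mat n → Set
InT {n} α A = UpperTriangular A × (∀ k → hook A k ≡ + α k)

e : ∀ {n} → Fin n → Fin n → Fin n → Fin n → ℕ
e i j p q = if ⌊ p ≟ i ⌋ ∧ ⌊ q ≟ j ⌋ then 1 else 0

-- A covers B (entries are naturals, so a_ik = b_ik - 1 forces b_ik ≥ 1)
data Covers {n} (A B : Mat n) : Set where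
  move₁ : (i j k : Fin n) → i <ᶠ j → j <ᶠ k →
          (∀ p q → A p q + e i k p q ≡ B p q + e i j p q + e j k p q) →
          Covers A B
  move₂ : (i j : Fin n) → i <ᶠ j →
          (∀ p q → A p q + e i i p q ≡ B p q + e i j p q + e j j p q) →
          Covers A B

-- diagonal matrix with diagonal α (least element of P(α))
diag : ∀ {n} → (Fin n → ℕ) → Mat n
diag α i j = if ⌊ i ≟ j ⌋ then α i else 0

data SatChain {n} (α : Fin n → ℕ) : Mat n → ℕ → Set where
  start : ∀ {A} → (∀ p q → A p q ≡ diag α p q) → SatChain α A 0
  step  : ∀ {A B m} → SatChain α B m → InT α A → Covers A B → SatChain α A (suc m)

-- Σ_{i=1}^n (n - i) α_i   (with 0-based t, n - i = n - (t+1))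
rankFormula : ∀ n → (Fin n → ℕ) → ℕ
rankFormula n α = Σ[ n ] λ t → (n ∸ suc (toℕ t)) * α t

RankOfTesler : ∀ n → (Fin n → ℕ) → ℕ → Set
RankOfTesler n α r =
  (Σ (Mat n) λ A → InT α A × SatChain α A r)
  × (∀ (A : Mat n) (m : ℕ) → InT α A → SatChain α A m → m ≤ r)

module Submission where

-- Let total(A) be the sum of all entries of A.  Each cover
-- relation raises total by exactly one, so an element of rank m satisfies
-- total(A) = m + Σ α.  Put wₜ = n − t + 1, so that w_i ≥ w_j + 1 for i < j.
-- Then for an upper-triangular A the entrywise inequality
--     a_ij + w_j·[i<j] a_ij  ≤  w_i·[i≤j] a_ij
-- sums to  total(A) + Σⱼ wⱼ Colⱼ ≤ Σᵢ wᵢ Rowᵢ,  and the hook equations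
-- Rowᵢ = αᵢ + Colᵢ turn the right side into Σ w α + Σⱼ wⱼ Colⱼ.  Hence
-- total(A) ≤ Σ w α = Σ α + Σ (n − t) αₜ, i.e. m ≤ Σ (n − t) αₜ.
--
-- Lower bound, by induction on n.  From diag(α), applying the move at
-- (1,2) α₁ times carries the first diagonal entry to position (1,2).  The
-- result is diag(α') bordered by the first row (0, α₁, 0, …, 0), where
-- α' = (α₂ + α₁, α₃, …, αₙ); bordering by that row embeds P(α') into P(α)
-- preserving covers, so a chain of maximal length in P(α') extends the first
-- α₁ steps, giving length α₁ + Σ (n − 1 − t) α'ₜ = Σ (n − t) αₜ.

open import Defs
open import Data.Nat using (ℕ; zero; suc; _+_; _*_; _∸_; _≤_; z≤n; s≤s)
open import Data.Nat.Properties
open import Data.Nat.Solver using (module +-*-Solver)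
open import Data.Fin using (Fin; toℕ) renaming (zero to fz; suc to fs; _<_ to _<ᶠ_; _≤_ to _≤ᶠ_)
import Data.Fin.Properties as FP
open import Data.List using (tabulate)
import Data.List.Properties as ListP
import Data.Nat.ListAction as ListAction
open import Data.Vec.Functional using (removeAt)
open import Algebra.Properties.Semiring.Sum +-*-semiring
  using (sum; sum-syntax; sum-remove; sum-cong-≗; sum-replicate-zero; ∑-distrib-+; ∑-comm; *-distribˡ-sum)
open import Data.Bool using (true; false; if_then_else_; _∧_)
open import Data.Bool.Properties using (∧-zeroʳ)
open import Data.Product using (Σ; _×_; _,_)
open import Data.Empty using (⊥-elim)
open import Data.Sum using (_⊎_; inj₁; inj₂)
open import Function using (id; _∘_)
open import Relation.Binary using (tri<; tri≈; tri>)
open import Relation.Binary.PropositionalEquality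
open import Relation.Nullary using (Dec; yes; no; ¬_)
open import Relation.Nullary.Decidable using (⌊_⌋)
import Data.Integer as ℤ
import Data.Integer.Properties as ℤP
import Algebra.Properties.AbelianGroup ℤP.+-0-abelianGroup as ℤGroup

Σ≡∑ : ∀ n (f : Fin n → ℕ) → Σ[ n ] f ≡ sum f
Σ≡∑ n f = trans (cong ListAction.sum (ListP.map-tabulate id f)) (sum-tabulate n f)
  where
  sum-tabulate : ∀ n (f : Fin n → ℕ) → ListAction.sum (tabulate f) ≡ sum f
  sum-tabulate zero f = refl
  sum-tabulate (suc n) f = cong (f fz +_) (sum-tabulate n (f ∘ fs))

∑-zero : ∀ {n} {f : Fin n → ℕ} → (∀ i → f i ≡ 0) → sum f ≡ 0
∑-zero {n} f≡0 = trans (sum-cong-≗ f≡0) (sum-replicate-zero n)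

∑-single : ∀ {n} (f : Fin n → ℕ) (j : Fin n) → (∀ q → q ≢ j → f q ≡ 0) → sum f ≡ f j
∑-single {suc n} f j off = begin
  sum f                    ≡⟨ sum-remove {i = j} f ⟩
  f j + sum (removeAt f j) ≡⟨ cong (f j +_) (∑-zero (λ k → off _ (FP.punchInᵢ≢i j k))) ⟩
  f j + 0                  ≡⟨ +-identityʳ (f j) ⟩
  f j                      ∎
  where open ≡-Reasoning

∑-mono-≤ : ∀ {n} {f g : Fin n → ℕ} → (∀ i → f i ≤ g i) → sum f ≤ sum g
∑-mono-≤ {zero} _ = z≤n
∑-mono-≤ {suc n} f≤g = +-mono-≤ (f≤g fz) (∑-mono-≤ (f≤g ∘ fs))

if-yes : ∀ {P : Set} {x y : ℕ} (d : Dec P) → P → (if ⌊ d ⌋ then x else y) ≡ x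
if-yes (yes _) _ = refl
if-yes (no ¬p) p = ⊥-elim (¬p p)

if-no : ∀ {P : Set} {x y : ℕ} (d : Dec P) → ¬ P → (if ⌊ d ⌋ then x else y) ≡ y
if-no (yes p) ¬p = ⊥-elim (¬p p)
if-no (no _) _ = refl

⌊⌋-cong : ∀ {P Q : Set} (p? : Dec P) (q? : Dec Q) → (P → Q) → (Q → P) → ⌊ p? ⌋ ≡ ⌊ q? ⌋
⌊⌋-cong (yes _) (yes _) _ _ = refl
⌊⌋-cong (no _) (no _) _ _ = refl
⌊⌋-cong (yes p) (no ¬q) to _ = ⊥-elim (¬q (to p))
⌊⌋-cong (no ¬p) (yes q) _ from = ⊥-elim (¬p (from q))

weakUpper strictUpper : ∀ {n} → Mat n → Fin n → Fin n → ℕ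
weakUpper A i j = if ⌊ i FP.≤? j ⌋ then A i j else 0
strictUpper A i j = if ⌊ i FP.<? j ⌋ then A i j else 0

Row Col : ∀ {n} → Mat n → Fin n → ℕ
Row {n} A k = ∑[ j < n ] weakUpper A k j
Col {n} A k = ∑[ i < n ] strictUpper A i k

hook≡Row-Col : ∀ {n} (A : Mat n) k → hook A k ≡ ℤ.+ Row A k ℤ.- ℤ.+ Col A k
hook≡Row-Col {n} A k = cong₂ (λ r c → ℤ.+ r ℤ.- ℤ.+ c) (Σ≡∑ n _) (Σ≡∑ n _)

minus⇒plus : ∀ r c a → ℤ.+ r ℤ.- ℤ.+ c ≡ ℤ.+ a → r ≡ a + c
minus⇒plus r c a eq = ℤP.+-injective (begin
  ℤ.+ r                          ≡⟨ ℤGroup.//-rightDividesˡ (ℤ.+ c) (ℤ.+ r) ⟨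
  (ℤ.+ r ℤ.- ℤ.+ c) ℤ.+ (ℤ.+ c)  ≡⟨ cong (ℤ._+ (ℤ.+ c)) eq ⟩
  (ℤ.+ a) ℤ.+ (ℤ.+ c)            ≡⟨ ℤP.pos-+ a c ⟨
  ℤ.+ (a + c)                    ∎)
  where open ≡-Reasoning

plus⇒minus : ∀ r c a → r ≡ a + c → ℤ.+ r ℤ.- ℤ.+ c ≡ ℤ.+ a
plus⇒minus r c a refl = begin
  ℤ.+ (a + c) ℤ.- ℤ.+ c            ≡⟨ cong (ℤ._- (ℤ.+ c)) (ℤP.pos-+ a c) ⟩
  ((ℤ.+ a) ℤ.+ (ℤ.+ c)) ℤ.- ℤ.+ c  ≡⟨ ℤGroup.//-rightDividesʳ (ℤ.+ c) (ℤ.+ a) ⟩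
  ℤ.+ a                            ∎
  where open ≡-Reasoning

hook⇒Row : ∀ {n} (A : Mat n) k {a} → hook A k ≡ ℤ.+ a → Row A k ≡ a + Col A k
hook⇒Row A k {a} h = minus⇒plus (Row A k) (Col A k) a (trans (sym (hook≡Row-Col A k)) h)

Row⇒hook : ∀ {n} (A : Mat n) k {a} → Row A k ≡ a + Col A k → hook A k ≡ ℤ.+ a
Row⇒hook A k {a} h = trans (hook≡Row-Col A k) (plus⇒minus (Row A k) (Col A k) a h)

_≐_ : ∀ {n} → Mat n → Mat n → Set
A ≐ B = ∀ p q → A p q ≡ B p q

Row-resp : ∀ {n} {A B : Mat n} → A ≐ B → ∀ k → Row A k ≡ Row B k
Row-resp A≐B k = sum-cong-≗ (λ j → cong (λ x → if ⌊ k FP.≤? j ⌋ then x else 0) (A≐B k j))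

Col-resp : ∀ {n} {A B : Mat n} → A ≐ B → ∀ k → Col A k ≡ Col B k
Col-resp A≐B k = sum-cong-≗ (λ i → cong (λ x → if ⌊ i FP.<? k ⌋ then x else 0) (A≐B i k))

InT-resp : ∀ {n} {α : Fin n → ℕ} {A B : Mat n} → B ≐ A → InT α A → InT α B
InT-resp {A = A} {B} B≐A (ut , hk) =
  (λ i j j<i → trans (B≐A i j) (ut i j j<i)) ,
  (λ k → Row⇒hook B k (begin
    Row B k         ≡⟨ Row-resp B≐A k ⟩
    Row A k         ≡⟨ hook⇒Row A k (hk k) ⟩
    _ + Col A k     ≡⟨ cong (_ +_) (Col-resp B≐A k) ⟨
    _ + Col B k     ∎))
  where open ≡-Reasoning

MoveEq : ∀ {n} → Mat n → Mat n → (x₁ x₂ y₁ y₂ z₁ z₂ : Fin n) → Set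
MoveEq A B x₁ x₂ y₁ y₂ z₁ z₂ = ∀ p q → A p q + e x₁ x₂ p q ≡ B p q + e y₁ y₂ p q + e z₁ z₂ p q

MoveEq-resp : ∀ {n} {A A' B : Mat n} {x₁ x₂ y₁ y₂ z₁ z₂} → A' ≐ A →
  MoveEq A B x₁ x₂ y₁ y₂ z₁ z₂ → MoveEq A' B x₁ x₂ y₁ y₂ z₁ z₂
MoveEq-resp {x₁ = x₁} {x₂} A'≐A eq p q = trans (cong (_+ e x₁ x₂ p q) (A'≐A p q)) (eq p q)

Covers-resp : ∀ {n} {A A' B : Mat n} → A' ≐ A → Covers A B → Covers A' B
Covers-resp A'≐A (move₁ i j k i<j j<k eq) = move₁ i j k i<j j<k (MoveEq-resp A'≐A eq)
Covers-resp A'≐A (move₂ i j i<j eq) = move₂ i j i<j (MoveEq-resp A'≐A eq)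

SatChain-resp : ∀ {n} {α : Fin n → ℕ} {A A' : Mat n} {m} → A' ≐ A → SatChain α A m → SatChain α A' m
SatChain-resp A'≐A (start A≐diag) = start (λ p q → trans (A'≐A p q) (A≐diag p q))
SatChain-resp A'≐A (step chain inT cover) = step chain (InT-resp A'≐A inT) (Covers-resp A'≐A cover)

total : ∀ {n} → Mat n → ℕ
total {n} A = ∑[ p < n ] ∑[ q < n ] A p q

total-resp : ∀ {n} {A B : Mat n} → A ≐ B → total A ≡ total B
total-resp A≐B = sum-cong-≗ (λ p → sum-cong-≗ (A≐B p))

total-+ : ∀ {n} (A B : Mat n) → total (λ p q → A p q + B p q) ≡ total A + total B
total-+ {n} A B = trans (sum-cong-≗ (λ p → ∑-distrib-+ (A p) (B p))) (∑-distrib-+ (λ p → ∑[ q < n ] A p q) _)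

total-single : ∀ {n} (A : Mat n) i j → (∀ p q → (p ≢ i ⊎ q ≢ j) → A p q ≡ 0) → total A ≡ A i j
total-single A i j off = trans
  (∑-single _ i (λ p p≢i → ∑-zero (λ q → off p q (inj₁ p≢i))))
  (∑-single (A i) j (λ q q≢j → off i q (inj₂ q≢j)))

total-e : ∀ {n} (i j : Fin n) → total (e i j) ≡ 1
total-e i j = trans (total-single (e i j) i j off) (if-both (i FP.≟ i) (j FP.≟ j))
  where
  off : ∀ p q → (p ≢ i ⊎ q ≢ j) → e i j p q ≡ 0
  off p q (inj₁ p≢i) with p FP.≟ i
  ... | yes p≡i = ⊥-elim (p≢i p≡i)
  ... | no _ = refl
  off p q (inj₂ q≢j) with p FP.≟ i | q FP.≟ j
  ... | _ | yes q≡j = ⊥-elim (q≢j q≡j)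
  ... | yes _ | no _ = refl
  ... | no _ | no _ = refl
  if-both : (d : Dec (i ≡ i)) (d' : Dec (j ≡ j)) → (if ⌊ d ⌋ ∧ ⌊ d' ⌋ then 1 else 0) ≡ 1
  if-both (yes _) (yes _) = refl
  if-both (no i≢i) _ = ⊥-elim (i≢i refl)
  if-both (yes _) (no j≢j) = ⊥-elim (j≢j refl)

MoveEq-total : ∀ {n} {A B : Mat n} {x₁ x₂ y₁ y₂ z₁ z₂} →
  MoveEq A B x₁ x₂ y₁ y₂ z₁ z₂ → total A ≡ suc (total B)
MoveEq-total {A = A} {B} {x₁} {x₂} {y₁} {y₂} {z₁} {z₂} eq = +-cancelʳ-≡ 1 _ _ (begin
  total A + 1                                           ≡⟨ cong (total A +_) (total-e x₁ x₂) ⟨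
  total A + total (e x₁ x₂)                             ≡⟨ total-+ A (e x₁ x₂) ⟨
  total (λ p q → A p q + e x₁ x₂ p q)                   ≡⟨ total-resp eq ⟩
  total (λ p q → B p q + e y₁ y₂ p q + e z₁ z₂ p q)     ≡⟨ total-+ _ (e z₁ z₂) ⟩
  total (λ p q → B p q + e y₁ y₂ p q) + total (e z₁ z₂) ≡⟨ cong₂ _+_ (total-+ B (e y₁ y₂)) (total-e z₁ z₂) ⟩
  total B + total (e y₁ y₂) + 1                         ≡⟨ cong (λ t → total B + t + 1) (total-e y₁ y₂) ⟩
  total B + 1 + 1                                       ≡⟨ cong (_+ 1) (+-comm (total B) 1) ⟩
  suc (total B) + 1                                     ∎)
  where open ≡-Reasoning

Covers-total : ∀ {n} {A B : Mat n} → Covers A B → total A ≡ suc (total B)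
Covers-total (move₁ _ _ _ _ _ eq) = MoveEq-total eq
Covers-total (move₂ _ _ _ eq) = MoveEq-total eq

diag-on : ∀ {n} (β : Fin n → ℕ) i → diag β i i ≡ β i
diag-on β i = if-yes (i FP.≟ i) refl

diag-off : ∀ {n} (β : Fin n → ℕ) {i j} → i ≢ j → diag β i j ≡ 0
diag-off β {i} {j} i≢j = if-no (i FP.≟ j) i≢j

diag-cong : ∀ {n} {β γ : Fin n → ℕ} → (∀ t → β t ≡ γ t) → diag β ≐ diag γ
diag-cong β≡γ p q = cong (λ x → if ⌊ p FP.≟ q ⌋ then x else 0) (β≡γ p)

diag-shift : ∀ {n} (β : Fin (suc n) → ℕ) p q → diag β (fs p) (fs q) ≡ diag (β ∘ fs) p q
diag-shift β p q = cong (λ b → if b then β (fs p) else 0) (⌊⌋-cong (fs p FP.≟ fs q) (p FP.≟ q) FP.suc-injective (cong fs))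

total-diag : ∀ {n} (β : Fin n → ℕ) → total (diag β) ≡ sum β
total-diag β = sum-cong-≗ (λ p →
  trans (∑-single (diag β p) p (λ q q≢p → diag-off β (q≢p ∘ sym))) (diag-on β p))

guard-zero : ∀ b {x : ℕ} → x ≡ 0 → (if b then x else 0) ≡ 0
guard-zero true x≡0 = x≡0
guard-zero false _ = refl

diag-InT : ∀ {n} (β : Fin n → ℕ) → InT β (diag β)
diag-InT β = (λ i j j<i → diag-off β (λ { refl → FP.<-irrefl refl j<i })) ,
  (λ k → Row⇒hook (diag β) k (begin
    Row (diag β) k      ≡⟨ Row-diag k ⟩
    β k                 ≡⟨ +-identityʳ (β k) ⟨
    β k + 0             ≡⟨ cong (β k +_) (Col-diag k) ⟨
    β k + Col (diag β) k ∎))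
  where
  open ≡-Reasoning
  Row-diag : ∀ k → Row (diag β) k ≡ β k
  Row-diag k = trans
    (∑-single _ k (λ j j≢k → guard-zero ⌊ k FP.≤? j ⌋ (diag-off β (j≢k ∘ sym))))
    (trans (if-yes (k FP.≤? k) FP.≤-refl) (diag-on β k))
  Col-diag : ∀ k → Col (diag β) k ≡ 0
  Col-diag k = ∑-zero strict-zero
    where
    strict-zero : ∀ i → strictUpper (diag β) i k ≡ 0
    strict-zero i with i FP.≟ k
    ... | yes refl = if-no (i FP.<? i) (FP.<-irrefl refl)
    ... | no _ = guard-zero _ refl

SatChain-total : ∀ {n} {α : Fin n → ℕ} {A : Mat n} {m} → SatChain α A m → total A ≡ m + sum α
SatChain-total {α = α} (start A≐diag) = trans (total-resp A≐diag) (total-diag α)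
SatChain-total (step chain _ cover) = trans (Covers-total cover) (cong suc (SatChain-total chain))

-- wₜ = n − t + 1 in 1-based indexing; it drops by at least one down the diagonal.
weight : ∀ n → Fin n → ℕ
weight n t = suc (n ∸ suc (toℕ t))

weight-decreasing : ∀ {n} (i j : Fin n) → i <ᶠ j → suc (weight n j) ≤ weight n i
weight-decreasing {n} i j i<j = s≤s (begin
  suc (n ∸ suc (toℕ j)) ≡⟨ +-∸-assoc 1 (FP.toℕ<n j) ⟨
  n ∸ toℕ j             ≤⟨ ∸-monoʳ-≤ n i<j ⟩
  n ∸ suc (toℕ i)       ∎)
  where open ≤-Reasoning

strict-yes : ∀ {n} (A : Mat n) {i j} → i <ᶠ j → strictUpper A i j ≡ A i j
strict-yes A {i} {j} = if-yes (i FP.<? j)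

strict-no : ∀ {n} (A : Mat n) {i j} → ¬ i <ᶠ j → strictUpper A i j ≡ 0
strict-no A {i} {j} = if-no (i FP.<? j)

weak-yes : ∀ {n} (A : Mat n) {i j} → i ≤ᶠ j → weakUpper A i j ≡ A i j
weak-yes A {i} {j} = if-yes (i FP.≤? j)

entry-bound : ∀ {n} {A : Mat n} → UpperTriangular A → ∀ i j →
  A i j + weight n j * strictUpper A i j ≤ weight n i * weakUpper A i j
entry-bound {n} {A} ut i j with FP.<-cmp i j
... | tri< i<j _ _ rewrite strict-yes A i<j | weak-yes A (<⇒≤ i<j) =
  *-monoˡ-≤ (A i j) (weight-decreasing i j i<j)
... | tri≈ _ refl _ rewrite strict-no A {i} {i} (FP.<-irrefl refl) | weak-yes A {i} {i} FP.≤-refl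
  | *-zeroʳ (weight n i) | +-identityʳ (A i i) = m≤m+n (A i i) _
... | tri> _ _ j<i rewrite strict-no A (FP.<-asym j<i) | ut i j j<i | *-zeroʳ (weight n j) = z≤n

total-bound : ∀ {n} (α : Fin n → ℕ) (A : Mat n) → InT α A → total A ≤ ∑[ t < n ] (weight n t * α t)
total-bound {n} α A (ut , hk) = +-cancelʳ-≤ X (total A) W (begin
  total A + X                                            ≡⟨ total-+ A weightedLegs ⟨
  total (λ i j → A i j + weightedLegs i j)               ≤⟨ ∑-mono-≤ (λ i → ∑-mono-≤ (entry-bound ut i)) ⟩
  ∑[ i < n ] ∑[ j < n ] (weight n i * weakUpper A i j)   ≡⟨ sum-cong-≗ (λ i → *-distribˡ-sum (weight n i) (weakUpper A i)) ⟨
  ∑[ i < n ] (weight n i * Row A i)                      ≡⟨ sum-cong-≗ (λ i → cong (weight n i *_) (hook⇒Row A i (hk i))) ⟩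
  ∑[ i < n ] (weight n i * (α i + Col A i))              ≡⟨ sum-cong-≗ (λ i → *-distribˡ-+ (weight n i) (α i) (Col A i)) ⟩
  ∑[ i < n ] (weight n i * α i + weight n i * Col A i)   ≡⟨ ∑-distrib-+ (λ i → weight n i * α i) _ ⟩
  W + ∑[ j < n ] (weight n j * Col A j)                  ≡⟨ cong (W +_) weightedCols ⟩
  W + X                                                  ∎)
  where
  open ≤-Reasoning
  W = ∑[ t < n ] (weight n t * α t)
  weightedLegs : Mat n
  weightedLegs i j = weight n j * strictUpper A i j
  X = total weightedLegs
  weightedCols : ∑[ j < n ] (weight n j * Col A j) ≡ X
  weightedCols = trans (sum-cong-≗ (λ j → *-distribˡ-sum (weight n j) (λ i → strictUpper A i j)))
                       (∑-comm (λ j i → weightedLegs i j))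

rank-bound : ∀ {n} (α : Fin n → ℕ) {A : Mat n} {m} → InT α A → SatChain α A m → m ≤ rankFormula n α
rank-bound {n} α {A} {m} inT chain = subst (m ≤_) (sym (Σ≡∑ n _)) (+-cancelʳ-≤ (sum α) m _ (begin
  m + sum α                                    ≡⟨ SatChain-total chain ⟨
  total A                                      ≤⟨ total-bound α A inT ⟩
  ∑[ t < n ] (weight n t * α t)                ≡⟨ ∑-distrib-+ α _ ⟩
  sum α + ∑[ t < n ] ((n ∸ suc (toℕ t)) * α t) ≡⟨ +-comm (sum α) _ ⟩
  ∑[ t < n ] ((n ∸ suc (toℕ t)) * α t) + sum α ∎))
  where open ≤-Reasoning

border : ∀ {n} → ℕ → (Fin n → ℕ) → Mat n → Mat (suc n)
border a r A fz fz = a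
border a r A fz (fs q) = r q
border a r A (fs p) fz = 0
border a r A (fs p) (fs q) = A p q

border-resp : ∀ {n} a (r : Fin n → ℕ) {A B : Mat n} → A ≐ B → border a r A ≐ border a r B
border-resp a r A≐B fz fz = refl
border-resp a r A≐B fz (fs q) = refl
border-resp a r A≐B (fs p) fz = refl
border-resp a r A≐B (fs p) (fs q) = A≐B p q

Row-border : ∀ {n} a (r : Fin n → ℕ) (A : Mat n) k → Row (border a r A) (fs k) ≡ Row A k
Row-border {n} a r A k = cong₂ _+_ (guard-zero ⌊ fs k FP.≤? fz {n} ⌋ refl)
  (sum-cong-≗ (λ j → cong (λ b → if b then A k j else 0) (⌊⌋-cong (fs k FP.≤? fs j) (k FP.≤? j) ≤-pred s≤s)))

Col-border : ∀ {n} a (r : Fin n → ℕ) (A : Mat n) k → Col (border a r A) (fs k) ≡ r k + Col A k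
Col-border {n} a r A k = cong₂ _+_ (if-yes {x = r k} {y = 0} (fz {n} FP.<? fs k) (s≤s z≤n))
  (sum-cong-≗ (λ i → cong (λ b → if b then A i k else 0) (⌊⌋-cong (fs i FP.<? fs k) (i FP.<? k) ≤-pred s≤s)))

border-hooks : ∀ {n} {α : Fin (suc n) → ℕ} {β : Fin n → ℕ} {a r} {A : Mat n} →
  a + sum r ≡ α fz → (∀ k → β k ≡ α (fs k) + r k) → InT β A → InT α (border a r A)
border-hooks {n} {α} {β} {a} {r} {A} first later (ut , hk) = upper , hooks
  where
  open ≡-Reasoning
  upper : UpperTriangular (border a r A)
  upper fz q ()
  upper (fs p) fz _ = refl
  upper (fs p) (fs q) (s≤s q<p) = ut p q q<p
  hooks : ∀ k → hook (border a r A) k ≡ ℤ.+ α k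
  hooks fz = Row⇒hook (border a r A) fz (begin
    a + sum r                   ≡⟨ first ⟩
    α fz                        ≡⟨ +-identityʳ (α fz) ⟨
    α fz + 0                    ≡⟨ cong (α fz +_) (∑-zero {n} (λ _ → refl)) ⟨
    α fz + Col (border a r A) fz ∎)
  hooks (fs k) = Row⇒hook (border a r A) (fs k) (begin
    Row (border a r A) (fs k)   ≡⟨ Row-border a r A k ⟩
    Row A k                     ≡⟨ hook⇒Row A k (hk k) ⟩
    β k + Col A k               ≡⟨ cong (_+ Col A k) (later k) ⟩
    α (fs k) + r k + Col A k    ≡⟨ +-assoc (α (fs k)) (r k) (Col A k) ⟩
    α (fs k) + (r k + Col A k)  ≡⟨ cong (α (fs k) +_) (Col-border a r A k) ⟨
    α (fs k) + Col (border a r A) (fs k) ∎)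

e-firstColumn : ∀ {n} (i : Fin (suc n)) (j : Fin n) p → e i (fs j) p fz ≡ 0
e-firstColumn i j p = cong (λ b → if b then 1 else 0) (∧-zeroʳ ⌊ p FP.≟ i ⌋)

e-shift : ∀ {n} (i j p q : Fin n) → e (fs i) (fs j) (fs p) (fs q) ≡ e i j p q
e-shift i j p q = cong₂ (λ b c → if b ∧ c then 1 else 0) (≟-shift p i) (≟-shift q j)
  where
  ≟-shift : ∀ x y → ⌊ fs x FP.≟ fs y ⌋ ≡ ⌊ x FP.≟ y ⌋
  ≟-shift x y = ⌊⌋-cong (fs x FP.≟ fs y) (x FP.≟ y) FP.suc-injective (cong fs)

border-MoveEq : ∀ {n} a (r : Fin n → ℕ) {A B : Mat n} {x₁ x₂ y₁ y₂ z₁ z₂} →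
  MoveEq A B x₁ x₂ y₁ y₂ z₁ z₂ →
  MoveEq (border a r A) (border a r B) (fs x₁) (fs x₂) (fs y₁) (fs y₂) (fs z₁) (fs z₂)
border-MoveEq a r eq fz fz = sym (+-identityʳ _)
border-MoveEq a r eq fz (fs q) = sym (+-identityʳ _)
border-MoveEq a r {x₁ = x₁} {x₂} {y₁} {y₂} {z₁} {z₂} eq (fs p) fz =
  trans (e-firstColumn (fs x₁) x₂ (fs p))
        (sym (cong₂ _+_ (e-firstColumn (fs y₁) y₂ (fs p)) (e-firstColumn (fs z₁) z₂ (fs p))))
border-MoveEq a r {x₁ = x₁} {x₂} {y₁} {y₂} {z₁} {z₂} eq (fs p) (fs q)
  rewrite e-shift x₁ x₂ p q | e-shift y₁ y₂ p q | e-shift z₁ z₂ p q = eq p q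

border-Covers : ∀ {n} a (r : Fin n → ℕ) {A B : Mat n} → Covers A B → Covers (border a r A) (border a r B)
border-Covers a r (move₁ i j k i<j j<k eq) = move₁ (fs i) (fs j) (fs k) (s≤s i<j) (s≤s j<k) (border-MoveEq a r eq)
border-Covers a r (move₂ i j i<j eq) = move₂ (fs i) (fs j) (s≤s i<j) (border-MoveEq a r eq)

TopElement : ∀ n → (Fin n → ℕ) → Set
TopElement n α = Σ (Mat n) λ A → InT α A × SatChain α A (rankFormula n α)

module FirstSteps {m : ℕ} (α : Fin (suc (suc m)) → ℕ) where

  firstRow : ℕ → Fin (suc m) → ℕ
  firstRow c fz = c
  firstRow c (fs _) = 0

  merged : ℕ → Fin (suc m) → ℕ
  merged c fz = α (fs fz) + c
  merged c (fs t) = α (fs (fs t))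

  lift : ℕ → Mat (suc m) → Mat (suc (suc m))
  lift c = border (α fz ∸ c) (firstRow c)

  lift-InT : ∀ {c A} → c ≤ α fz → InT (merged c) A → InT α (lift c A)
  lift-InT {c} c≤α₁ = border-hooks first later
    where
    open ≡-Reasoning
    first : α fz ∸ c + sum (firstRow c) ≡ α fz
    first = begin
      α fz ∸ c + (c + sum {m} (λ _ → 0)) ≡⟨ cong (λ s → α fz ∸ c + (c + s)) (∑-zero {m} (λ _ → refl)) ⟩
      α fz ∸ c + (c + 0)                 ≡⟨ cong (α fz ∸ c +_) (+-identityʳ c) ⟩
      α fz ∸ c + c                       ≡⟨ m∸n+n≡m c≤α₁ ⟩
      α fz                               ∎
    later : ∀ k → merged c k ≡ α (fs k) + firstRow c k
    later fz = refl
    later (fs t) = sym (+-identityʳ _)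

  X : ℕ → Mat (suc (suc m))
  X c = lift c (diag (merged c))

  X₀≐diag : X 0 ≐ diag α
  X₀≐diag fz fz = refl
  X₀≐diag fz (fs fz) = refl
  X₀≐diag fz (fs (fs q)) = refl
  X₀≐diag (fs p) fz = refl
  X₀≐diag (fs p) (fs q) = trans (diag-cong merged₀ p q) (sym (diag-shift α p q))
    where
    merged₀ : ∀ t → merged 0 t ≡ α (fs t)
    merged₀ fz = +-identityʳ (α (fs fz))
    merged₀ (fs t) = refl

  -- the move at positions (1,2): one unit leaves a₁₁ and enters both a₁₂ and a₂₂
  X-step : ∀ c → suc c ≤ α fz → MoveEq (X (suc c)) (X c) fz fz fz (fs fz) (fs fz) (fs fz)
  X-step c c<α₁ fz fz = begin
    α fz ∸ suc c + 1       ≡⟨ +-comm (α fz ∸ suc c) 1 ⟩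
    1 + (α fz ∸ suc c)     ≡⟨ +-∸-assoc 1 c<α₁ ⟨
    α fz ∸ c               ≡⟨ +-identityʳ (α fz ∸ c) ⟨
    α fz ∸ c + 0           ≡⟨ +-identityʳ (α fz ∸ c + 0) ⟨
    α fz ∸ c + 0 + 0       ∎
    where open ≡-Reasoning
  X-step c _ fz (fs fz) = trans (+-identityʳ (suc c)) (sym (trans (+-identityʳ (c + 1)) (+-comm c 1)))
  X-step c _ fz (fs (fs q)) = refl
  X-step c _ (fs p) fz = sym (e-firstColumn (fs fz) fz (fs p))
  X-step c _ (fs fz) (fs fz) = begin
    α (fs fz) + suc c + 0     ≡⟨ +-identityʳ _ ⟩
    α (fs fz) + suc c         ≡⟨ +-suc (α (fs fz)) c ⟩
    suc (α (fs fz) + c)       ≡⟨ +-comm 1 _ ⟩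
    α (fs fz) + c + 1         ≡⟨ cong (_+ 1) (+-identityʳ _) ⟨
    α (fs fz) + c + 0 + 1     ∎
    where open ≡-Reasoning
  X-step c _ (fs fz) (fs (fs q)) = refl
  X-step c _ (fs (fs p)) (fs fz) = refl
  X-step c _ (fs (fs p)) (fs (fs q)) = sym (+-identityʳ _)

  X-chain : ∀ c → c ≤ α fz → SatChain α (X c) c
  X-chain zero _ = start X₀≐diag
  X-chain (suc c) c<α₁ =
    step (X-chain c (<⇒≤ c<α₁)) (lift-InT c<α₁ (diag-InT (merged (suc c)))) (move₂ fz (fs fz) (s≤s z≤n) (X-step c c<α₁))

  extend : ∀ {B k} → SatChain (merged (α fz)) B k → SatChain α (lift (α fz) B) (k + α fz)
  extend (start B≐diag) = SatChain-resp (border-resp _ _ B≐diag) (X-chain (α fz) ≤-refl)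
  extend (step chain inT cover) = step (extend chain) (lift-InT ≤-refl inT) (border-Covers _ _ cover)

  rankFormula-merge : rankFormula (suc (suc m)) α ≡ rankFormula (suc m) (merged (α fz)) + α fz
  rankFormula-merge = begin
    rankFormula (suc (suc m)) α                       ≡⟨ Σ≡∑ (suc (suc m)) (λ t → (suc (suc m) ∸ suc (toℕ t)) * α t) ⟩
    suc m * α₁ + (m * α₂ + T)                         ≡⟨ ring α₁ α₂ m T ⟩
    m * (α₂ + α₁) + T + α₁                            ≡⟨ cong (_+ α₁) (Σ≡∑ (suc m) (λ t → (suc m ∸ suc (toℕ t)) * merged α₁ t)) ⟨
    rankFormula (suc m) (merged (α fz)) + α₁          ∎
    where
    open ≡-Reasoning
    open +-*-Solver
    α₁ = α fz
    α₂ = α (fs fz)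
    T = ∑[ t < m ] ((m ∸ suc (toℕ t)) * α (fs (fs t)))
    ring : ∀ a b k s → suc k * a + (k * b + s) ≡ k * (b + a) + s + a
    ring = solve 4 (λ a b k s → (con 1 :+ k) :* a :+ (k :* b :+ s) := k :* (b :+ a) :+ s :+ a) refl

  extend-top : TopElement (suc m) (merged (α fz)) → TopElement (suc (suc m)) α
  extend-top (A , inT , chain) =
    lift (α fz) A , lift-InT ≤-refl inT , subst (SatChain α _) (sym rankFormula-merge) (extend chain)

-- P(α) has an element of rank Σ (n − t) αₜ: the matrix reached by moving
-- each αₜ as far along the superdiagonal as possible.
top-element : ∀ n (α : Fin n → ℕ) → TopElement n α
top-element zero α = (λ ()) , ((λ ()) , (λ ())) , start (λ ())
top-element (suc zero) α = diag α , diag-InT α , start (λ _ _ → refl)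
top-element (suc (suc m)) α = FirstSteps.extend-top α (top-element (suc m) _)

mainTheorem5 : (n : ℕ) (α : Fin n → ℕ) → RankOfTesler n α (rankFormula n α)
mainTheorem5 n α = top-element n α , λ A m inT chain → rank-bound α inT chain
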